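{- Let $G$ be a 2-connected outerplane bipartite graph, and let $f,f'$ be distinct inner faces with $f'\preceq f$ in $\mathbf{F}(G)$. Then in any $Z$-transformation sequence of $G$ from $M^{\hat1}$ to $M^{\hat0}$, the face $f'$ always appears after $f$. Consequently, the $Z$-transformation of $G$ is simple: in any $Z$-transformation sequence of $G$ every inner face is transformed at most once.
   Context: A connected plane graph is outerplane if all vertices lie on the boundary of the outer face. Fix a proper white/black coloring. Orient the dual $G^*$: the dual edge $e^*$ goes from $f_1^*$ to $f_2^*$ if, going along $e^*$ from $f_1^*$ to $f_2^*$, the white end-vertex of $e$ lies on the right; deleting the vertex of the outer face gives $\vec G^\#$. $\mathbf{F}(G)$ is the poset on inner faces with $f_1\preceq f_2$ iff $\vec G^\#$ has a directed path from $f_2^*$ to $f_1^*$. A 1-factor is a perfect matching, $\mathcal{M}(G)$ the set of them; for $M\in\mathcal{M}(G)$ a cycle is $M$-alternating if its edges alternate in/out of $M$, and proper (resp. improper) if each of its edges in $M$ goes from white to black (resp. black to white) end-vertex along the clockwise orientation. $\vec Z(G)$ has vertex set $\mathcal{M}(G)$ and an arc $M_1\to M_2$ when $M_1\oplus M_2$ bounds an inner face and is a proper $M_1$-alternating cycle; $\mathbf{M}(G)$ is the poset with $M_1\preceq M_2$ iff there is a directed path from $M_2$ to $M_1$. Such $G$ is elementary and $\mathbf{M}(G)$ is a finite distributive lattice with greatest element $M^{\hat1}$ and least element $M^{\hat0}$. A $Z$-transformation sequence from $M$ to $M'$ is a directed path $M=M_0,M_1,\dots,M_k=M'$ in $\vec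 Z(G)$, with associated face sequence $f_1,\dots,f_k$, where $f_i$ is the inner face bounded by $M_{i-1}\oplus M_i$. -}

module Defs where

open import Data.Nat as ℕ using (ℕ; zero; suc; _≤_)
open import Data.Fin using (Fin; toℕ)
open import Data.Fin as F using ()
open import Data.Bool using (Bool; true; false)
open import Data.List using (List; []; _∷_; _++_; take; length; lookup)
open import Data.List.Membership.Propositional using (_∈_)
open import Data.List.Relation.Unary.All using (All)
open import Data.List.Relation.Unary.Linked using (Linked)
open import Data.List.Relation.Unary.Unique.Propositional using (Unique)
open import Data.Product using (Σ; ∃; _×_; _,_)
open import Data.Sum using (_⊎_)
open import Relation.Nullary using (¬_)
open import Relation.Binary.PropositionalEquality using (_≡_; _≢_)
open import Relation.Binary.Construct.Closure.ReflexiveTransitive using (Star)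

-- Vertices are Fin n, listed 0,1,…,n-1 in CLOCKWISE order along the
-- boundary of the outer face (a Hamiltonian cycle).  Every other edge is
-- a chord (a , b) with a < b, drawn inside the cycle; chords are pairwise
-- non-crossing.  Every 2-connected outerplane (simple) graph is, as a
-- plane graph, isomorphic to exactly such a configuration.

record Outerplane : Set where
  field
    n        : ℕ
    3≤n      : 3 ≤ n
    chords   : List (Fin n × Fin n)
    chord-ok : All (λ e → let (a , b) = e in
                   (suc (suc (toℕ a)) ≤ toℕ b) × ¬ (toℕ a ≡ 0 × suc (toℕ b) ≡ n))
                   chords
    chords-unique : Unique chords
    noncrossing : ∀ a b c d → (a , b) ∈ chords → (c , d) ∈ chords →
                  ¬ (a F.< c × c F.< b × b F.< d)

module _ (G : Outerplane) where
  open Outerplane G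

  Vertex : Set
  Vertex = Fin n

  OuterEdge : Vertex → Vertex → Set
  OuterEdge u v = suc (toℕ u) ≡ toℕ v ⊎ (suc (toℕ u) ≡ n × toℕ v ≡ 0)

  Adj : Vertex → Vertex → Set
  Adj u v = OuterEdge u v ⊎ OuterEdge v u ⊎ (u , v) ∈ chords ⊎ (v , u) ∈ chords

  -- the fixed white/black colouring: c v ≡ true means v is white
  ProperColouring : (Vertex → Bool) → Set
  ProperColouring c = ∀ u v → Adj u v → c u ≢ c v

  -- An inner face is given by its boundary vertex list in
  -- increasing order, which is its clockwise boundary order.

  data Consec {A : Set} : List A → A → A → Set where
    here  : ∀ {x y xs} → Consec (x ∷ y ∷ xs) x y
    there : ∀ {x xs u v} → Consec xs u v → Consec (x ∷ xs) u v

  CycSucc : List Vertex → Vertex → Vertex → Set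
  CycSucc f u v = Consec (f ++ take 1 f) u v

  Face : Set
  Face = List Vertex

  IsInnerFace : Face → Set
  IsInnerFace f =
    Linked F._<_ f ×
    3 ≤ length f ×
    (∀ u v → CycSucc f u v → Adj u v) ×
    (∀ u v → u ∈ f → v ∈ f → Adj u v → CycSucc f u v ⊎ CycSucc f v u)

  -- The oriented dual with the outer face deleted.  Only chords separate
  -- two inner faces.  For a chord (a , b), a < b, the face on the side of
  -- the boundary vertices a, a+1, …, b is called the [a,b]-side face.
  -- Walking across the chord from the [a,b]-side face to the other face,
  -- the endpoint a lies on the right.  Hence the dual arc goes from the
  -- [a,b]-side face to the other one iff a is white.

  InSide : Face → Vertex → Vertex → Set
  InSide f a b = All (λ v → toℕ a ≤ toℕ v × toℕ v ≤ toℕ b) f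

  module _ (c : Vertex → Bool) where

    DualArc : Face → Face → Set
    DualArc f g =
      IsInnerFace f × IsInnerFace g × f ≢ g ×
      Σ Vertex λ a → Σ Vertex λ b → (a , b) ∈ chords ×
        a ∈ f × b ∈ f × a ∈ g × b ∈ g ×
        ((InSide f a b × c a ≡ true) ⊎ (InSide g a b × c b ≡ true))

    _⪯F_ : Face → Face → Set
    f₁ ⪯F f₂ = Star DualArc f₂ f₁

    IsPM : (Vertex → Vertex) → Set
    IsPM m = (∀ v → m (m v) ≡ v) × (∀ v → Adj v (m v))

    -- M₁ ⊕ M₂ is the boundary of the inner face f and is a proper
    -- M₁-alternating cycle: along the clockwise orientation of ∂f every
    -- M₁-edge goes from its white end to its black end.
    ZStep : Face → (Vertex → Vertex) → (Vertex → Vertex) → Set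
    ZStep f m₁ m₂ =
      IsInnerFace f ×
      (∀ v → ¬ (v ∈ f) → m₁ v ≡ m₂ v) ×
      (∀ v → v ∈ f → c v ≡ true  → CycSucc f v (m₁ v) × CycSucc f (m₂ v) v) ×
      (∀ v → v ∈ f → c v ≡ false → CycSucc f (m₁ v) v × CycSucc f v (m₂ v))

    -- Z-transformation sequences (directed paths in Z(G)) with their
    -- associated face sequence.  Matchings are compared pointwise.
    data ZSeq : (Vertex → Vertex) → (Vertex → Vertex) → List Face → Set where
      done : ∀ {m m'} → IsPM m → (∀ v → m v ≡ m' v) → ZSeq m m' []
      step : ∀ {m₁ m₂ m₃ f fs} → IsPM m₁ → IsPM m₂ → ZStep f m₁ m₂ →
             ZSeq m₂ m₃ fs → ZSeq m₁ m₃ (f ∷ fs)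

    _⪯M_ : (Vertex → Vertex) → (Vertex → Vertex) → Set
    m ⪯M m' = ∃ λ fs → ZSeq m' m fs

    IsTop : (Vertex → Vertex) → Set
    IsTop m = IsPM m × (∀ m' → IsPM m' → m' ⪯M m)

    IsBottom : (Vertex → Vertex) → Set
    IsBottom m = IsPM m × (∀ m' → IsPM m' → m ⪯M m')

module Submission where

-- Since chords do not cross, no edge at a vertex v of an inner
-- face f enters the angle of f at v (the clockwise range strictly between the successor and the
-- predecessor of v on the boundary of f); so an inner face is determined by any directed boundary
-- edge, and distinct faces at v have disjoint angles there.
--
-- Simplicity.  Let α be the first vertex of an inner face y and u its clockwise successor on y.
-- A Z-step at y moves the partner of α across the angle of y at α, from u to the predecessor of α
-- if α is white and back if α is black; a Z-step at another face moves it within the angle of that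
-- face, which lies on one side of u.  So whether y is flipped (the partner of α lies beyond u for
-- white α, up to u for black α) changes only at Z-steps at y, and only from false to true: y is
-- transformed at most once.
--
-- Order.  Matching every white vertex to its clockwise neighbour on the outer cycle leaves every
-- face unflipped, so no Z-transformation sequence of positive length ends there: it is the top
-- matching.  For a dual arc x → y the chord shared by x and y runs from black to white along x and
-- from white to black along y, while a proper Z-step at a face matches its black-to-white boundary
-- edges and unmatches its white-to-black ones.  The chord is unmatched at the top, only a step at x
-- matches it and a step at y needs it matched, so y is preceded by x; induction along a dual path
-- from f to f′ gives the theorem.

open import Defs
open import Data.Nat as ℕ using (ℕ; zero; suc; z≤n; s≤s; _∸_; _+_)
open import Data.Nat.Properties
open import Data.Bool using (Bool; true; false; not; if_then_else_)
open import Data.Bool.Properties using (¬-not)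
open import Data.Fin as F using (Fin; toℕ; fromℕ<; _<_; _≤_)
open import Data.Fin.Properties using (toℕ-injective; toℕ<n; toℕ-fromℕ<)
open import Data.List using (List; []; _∷_; _++_; length; lookup)
open import Data.List.Properties using (≡-dec)
open import Data.List.Membership.Propositional using (_∈_; _∉_)
open import Data.List.Membership.Propositional.Properties using (∈-lookup)
open import Data.List.Relation.Unary.Any using (here; there)
open import Data.List.Relation.Unary.All as All using (All; []; _∷_)
open import Data.List.Relation.Unary.AllPairs using ([]; _∷_)
open import Data.List.Relation.Unary.Linked as Linked using (Linked; _∷_)
open import Data.List.Relation.Unary.Unique.Propositional using (Unique)
open import Data.Product using (Σ; ∃; ∃₂; _×_; _,_; proj₁; proj₂)
open import Data.Sum as Sum using (_⊎_; inj₁; inj₂)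
open import Data.Empty using (⊥; ⊥-elim)
open import Function using (id; _∘_)
open import Function.Bundles using (_⇔_; mk⇔; Equivalence)
import Function.Properties.Equivalence as ⇔
open import Relation.Nullary using (¬_; yes; no)
open import Relation.Binary using (tri<; tri≈; tri>)
open import Relation.Binary.PropositionalEquality
  using (_≡_; _≢_; refl; sym; trans; cong; cong₂; subst; subst₂; module ≡-Reasoning)
open import Relation.Binary.Construct.Closure.ReflexiveTransitive using (Star; ε; _◅_)

lookup-injective : ∀ {A : Set} {xs : List A} → Unique xs →
                   ∀ i j → lookup xs i ≡ lookup xs j → i ≡ j
lookup-injective (_ ∷ _)      F.zero    F.zero    _ = refl
lookup-injective (x∉xs ∷ _)   F.zero    (F.suc j) x≡xⱼ  = ⊥-elim (All.lookup x∉xs (∈-lookup j) x≡xⱼ)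
lookup-injective (x∉xs ∷ _)   (F.suc i) F.zero    xᵢ≡x  = ⊥-elim (All.lookup x∉xs (∈-lookup i) (sym xᵢ≡x))
lookup-injective (_ ∷ unique) (F.suc i) (F.suc j) xᵢ≡xⱼ =
  cong F.suc (lookup-injective unique i j xᵢ≡xⱼ)

module CyclicLists (G : Outerplane) where
  open Outerplane G using (n)

  Sorted : List (Fin n) → Set
  Sorted = Linked _<_

  lastOf : Fin n → List (Fin n) → Fin n
  lastOf h []      = h
  lastOf _ (h ∷ t) = lastOf h t

  head<∈tail : ∀ {h t z} → Sorted (h ∷ t) → z ∈ t → h < z
  head<∈tail (h<h′ ∷ _) (here refl) = h<h′
  head<∈tail (h<h′ ∷ s) (there z∈t) = <-trans h<h′ (head<∈tail s z∈t)

  head≤∈ : ∀ {h t z} → Sorted (h ∷ t) → z ∈ h ∷ t → h ≤ z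
  head≤∈ s (here refl) = ≤-refl
  head≤∈ s (there z∈t) = <⇒≤ (head<∈tail s z∈t)

  lastOf-∈ : ∀ h t → lastOf h t ∈ h ∷ t
  lastOf-∈ h []      = here refl
  lastOf-∈ _ (h ∷ t) = there (lastOf-∈ h t)

  ∈⇒≤lastOf : ∀ {h t z} → Sorted (h ∷ t) → z ∈ h ∷ t → z ≤ lastOf h t
  ∈⇒≤lastOf {t = []}    _       (here refl) = ≤-refl
  ∈⇒≤lastOf {t = _ ∷ _} (p ∷ s) (here refl) = <⇒≤ (<-≤-trans p (∈⇒≤lastOf s (here refl)))
  ∈⇒≤lastOf {t = _ ∷ _} (_ ∷ s) (there z∈t) = ∈⇒≤lastOf s z∈t

  consec-∈ : ∀ {A : Set} {l : List A} {x y} → Consec G l x y → x ∈ l × y ∈ l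
  consec-∈ here      = here refl , there (here refl)
  consec-∈ (there c) = let x∈ , y∈ = consec-∈ c in there x∈ , there y∈

  consec-< : ∀ {l x y} → Sorted l → Consec G l x y → x < y
  consec-< (x<y ∷ _) here      = x<y
  consec-< s         (there c) = consec-< (Linked.tail s) c

  consec-gap : ∀ {l x y z} → Sorted l → Consec G l x y → z ∈ l → x < z → z < y → ⊥
  consec-gap s here (here refl) x<z _ = <-irrefl refl x<z
  consec-gap s here (there (here refl)) _ z<y = <-irrefl refl z<y
  consec-gap (_ ∷ s) here (there (there z∈)) _ z<y = <-asym z<y (head<∈tail s z∈)
  consec-gap s (there c) (here refl) x<z _ = <-asym x<z (head<∈tail s (proj₁ (consec-∈ c)))
  consec-gap s (there c) (there z∈) = consec-gap (Linked.tail s) c z∈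

  consec-injectiveʳ : ∀ {l x y y′} → Sorted l → Consec G l x y → Consec G l x y′ → y ≡ y′
  consec-injectiveʳ s c c′ with <-cmp (toℕ _) (toℕ _)
  ... | tri< y<y′ _ _ = ⊥-elim (consec-gap s c′ (proj₂ (consec-∈ c)) (consec-< s c) y<y′)
  ... | tri≈ _ y≡y′ _ = toℕ-injective y≡y′
  ... | tri> _ _ y′<y = ⊥-elim (consec-gap s c (proj₂ (consec-∈ c′)) (consec-< s c′) y′<y)

  consec-injectiveˡ : ∀ {l x x′ y} → Sorted l → Consec G l x y → Consec G l x′ y → x ≡ x′
  consec-injectiveˡ s c c′ with <-cmp (toℕ _) (toℕ _)
  ... | tri< x<x′ _ _ = ⊥-elim (consec-gap s c (proj₁ (consec-∈ c′)) x<x′ (consec-< s c′))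
  ... | tri≈ _ x≡x′ _ = toℕ-injective x≡x′
  ... | tri> _ _ x′<x = ⊥-elim (consec-gap s c′ (proj₁ (consec-∈ c)) x′<x (consec-< s c))

  consec-++ : ∀ {A : Set} {l : List A} r {x y} → Consec G l x y → Consec G (l ++ r) x y
  consec-++ r here      = here
  consec-++ r (there c) = there (consec-++ r c)

  consec-snoc⇒ : ∀ h t {z x y} → Consec G ((h ∷ t) ++ z ∷ []) x y →
                 Consec G (h ∷ t) x y ⊎ (x ≡ lastOf h t × y ≡ z)
  consec-snoc⇒ _ []       here              = inj₂ (refl , refl)
  consec-snoc⇒ _ []       (there (there ()))
  consec-snoc⇒ _ (_ ∷ _)  here              = inj₁ here
  consec-snoc⇒ _ (h ∷ t)  (there c) with consec-snoc⇒ h t c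
  ... | inj₁ c′ = inj₁ (there c′)
  ... | inj₂ e  = inj₂ e

  consec-or-last : ∀ h t {x} → x ∈ h ∷ t → (∃ λ y → Consec G (h ∷ t) x y) ⊎ x ≡ lastOf h t
  consec-or-last _ []       (here refl) = inj₂ refl
  consec-or-last _ (h ∷ _)  (here refl) = inj₁ (h , here)
  consec-or-last _ (h ∷ t)  (there x∈) with consec-or-last h t x∈
  ... | inj₁ (y , c) = inj₁ (y , there c)
  ... | inj₂ e       = inj₂ e

  consec-last : ∀ h t z → Consec G ((h ∷ t) ++ z ∷ []) (lastOf h t) z
  consec-last _ []      _ = here
  consec-last _ (h ∷ t) z = there (consec-last h t z)

  consec⇒cycSucc : ∀ {l x y} → Consec G l x y → CycSucc G l x y
  consec⇒cycSucc = consec-++ _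

  cycSucc-wrap : ∀ h t → CycSucc G (h ∷ t) (lastOf h t) h
  cycSucc-wrap h t = consec-last h t h

  cycSucc⇒ : ∀ {h t x y} → CycSucc G (h ∷ t) x y →
             Consec G (h ∷ t) x y ⊎ (x ≡ lastOf h t × y ≡ h)
  cycSucc⇒ = consec-snoc⇒ _ _

  cycSucc-∈ : ∀ {h t x y} → CycSucc G (h ∷ t) x y → x ∈ h ∷ t × y ∈ h ∷ t
  cycSucc-∈ {h} {t} c with cycSucc⇒ c
  ... | inj₁ c′            = consec-∈ c′
  ... | inj₂ (refl , refl) = lastOf-∈ h t , here refl

  cycSucc-total : ∀ {h t x} → x ∈ h ∷ t → ∃ λ y → CycSucc G (h ∷ t) x y
  cycSucc-total {h} {t} x∈ with consec-or-last h t x∈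
  ... | inj₁ (y , c) = y , consec⇒cycSucc c
  ... | inj₂ refl    = h , cycSucc-wrap h t

  cycSucc-injectiveʳ : ∀ {h t x y y′} → Sorted (h ∷ t) →
                       CycSucc G (h ∷ t) x y → CycSucc G (h ∷ t) x y′ → y ≡ y′
  cycSucc-injectiveʳ s c c′ with cycSucc⇒ c | cycSucc⇒ c′
  ... | inj₁ d            | inj₁ d′            = consec-injectiveʳ s d d′
  ... | inj₁ d            | inj₂ (refl , refl) =
    ⊥-elim (<-irrefl refl (<-≤-trans (consec-< s d) (∈⇒≤lastOf s (proj₂ (consec-∈ d)))))
  ... | inj₂ (refl , refl) | inj₁ d′           =
    ⊥-elim (<-irrefl refl (<-≤-trans (consec-< s d′) (∈⇒≤lastOf s (proj₂ (consec-∈ d′)))))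
  ... | inj₂ (_ , refl)   | inj₂ (_ , refl)    = refl

  cycSucc-injectiveˡ : ∀ {h t x x′ y} → Sorted (h ∷ t) →
                       CycSucc G (h ∷ t) x y → CycSucc G (h ∷ t) x′ y → x ≡ x′
  cycSucc-injectiveˡ s c c′ with cycSucc⇒ c | cycSucc⇒ c′
  ... | inj₁ d            | inj₁ d′            = consec-injectiveˡ s d d′
  ... | inj₁ d            | inj₂ (refl , refl) =
    ⊥-elim (<-irrefl refl (<-≤-trans (consec-< s d) (head≤∈ s (proj₁ (consec-∈ d)))))
  ... | inj₂ (refl , refl) | inj₁ d′           =
    ⊥-elim (<-irrefl refl (<-≤-trans (consec-< s d′) (head≤∈ s (proj₁ (consec-∈ d′)))))
  ... | inj₂ (refl , _)   | inj₂ (refl , _)    = refl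

  cycSucc-closed : ∀ (P : Fin n → Set) {h t x} →
                   (∀ {a b} → CycSucc G (h ∷ t) a b → P a → P b) →
                   x ∈ h ∷ t → P x → All P (h ∷ t)
  cycSucc-closed P {h} {t} closed x∈ Px =
    walk h t closedᶜ (closed (cycSucc-wrap h t) (reachLast h t closedᶜ x∈ Px))
    where
    closedᶜ : ∀ {a b} → Consec G (h ∷ t) a b → P a → P b
    closedᶜ c = closed (consec⇒cycSucc c)

    walk : ∀ h t → (∀ {a b} → Consec G (h ∷ t) a b → P a → P b) → P h → All P (h ∷ t)
    walk h []       _  Ph = Ph ∷ []
    walk h (h′ ∷ t) cl Ph = Ph ∷ walk h′ t (λ c → cl (there c)) (cl here Ph)

    reachLast : ∀ h t → (∀ {a b} → Consec G (h ∷ t) a b → P a → P b) →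
                ∀ {x} → x ∈ h ∷ t → P x → P (lastOf h t)
    reachLast h t        cl (here refl) Px = All.lookup (walk h t cl Px) (lastOf-∈ h t)
    reachLast h (h′ ∷ t) cl (there x∈)  Px = reachLast h′ t (λ c → cl (there c)) x∈ Px

  sorted-≡ : ∀ {l₁ l₂} → Sorted l₁ → Sorted l₂ →
             (∀ {z} → z ∈ l₁ → z ∈ l₂) → (∀ {z} → z ∈ l₂ → z ∈ l₁) → l₁ ≡ l₂
  sorted-≡ {[]}    {[]}    _ _ _ _ = refl
  sorted-≡ {[]}    {_ ∷ _} _ _ _ ⊇ with ⊇ (here refl)
  ... | ()
  sorted-≡ {_ ∷ _} {[]}    _ _ ⊆ _ with ⊆ (here refl)
  ... | ()
  sorted-≡ {h₁ ∷ t₁} {h₂ ∷ t₂} s₁ s₂ ⊆ ⊇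
    with toℕ-injective (≤-antisym (head≤∈ s₁ (⊇ (here refl))) (head≤∈ s₂ (⊆ (here refl))))
  ... | refl = cong (h₁ ∷_) (sorted-≡ (Linked.tail s₁) (Linked.tail s₂) (tail⊆ s₁ ⊆) (tail⊆ s₂ ⊇))
    where
    tail⊆ : ∀ {t t′} → Sorted (h₁ ∷ t) → (∀ {z} → z ∈ h₁ ∷ t → z ∈ h₁ ∷ t′) →
            ∀ {z} → z ∈ t → z ∈ t′
    tail⊆ s sub z∈ with sub (there z∈)
    ... | here refl = ⊥-elim (<-irrefl refl (head<∈tail s z∈))
    ... | there z∈′ = z∈′

  locate : ∀ {h t w} → Sorted (h ∷ t) → w ∉ h ∷ t →
           w < h ⊎ (∃₂ λ a b → Consec G (h ∷ t) a b × a < w × w < b) ⊎ lastOf h t < w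
  locate {h} {t} {w} s w∉ with <-cmp (toℕ w) (toℕ h)
  ... | tri< w<h _ _ = inj₁ w<h
  ... | tri≈ _ w≡h _ = ⊥-elim (w∉ (here (toℕ-injective w≡h)))
  ... | tri> _ _ h<w with t | s
  ...   | []      | _      = inj₂ (inj₂ h<w)
  ...   | h′ ∷ t′ | _ ∷ s′ with locate s′ (λ w∈ → w∉ (there w∈))
  ...     | inj₁ w<h′                           = inj₂ (inj₁ (h , h′ , here , h<w , w<h′))
  ...     | inj₂ (inj₁ (a , b , c , a<w , w<b)) = inj₂ (inj₁ (a , b , there c , a<w , w<b))
  ...     | inj₂ (inj₂ last<w)                  = inj₂ (inj₂ last<w)

module Clockwise (n : ℕ) where

  cwDist : Fin n → Fin n → ℕ
  cwDist v x with toℕ v ≤? toℕ x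
  ... | yes _ = toℕ x ∸ toℕ v
  ... | no _  = n ∸ toℕ v + toℕ x

  cwDist-≥ : ∀ {v x} → v ≤ x → cwDist v x ≡ toℕ x ∸ toℕ v
  cwDist-≥ {v} {x} v≤x with toℕ v ≤? toℕ x
  ... | yes _  = refl
  ... | no v≰x = ⊥-elim (v≰x v≤x)

  cwDist-< : ∀ {v x} → x < v → cwDist v x ≡ n ∸ toℕ v + toℕ x
  cwDist-< {v} {x} x<v with toℕ v ≤? toℕ x
  ... | yes v≤x = ⊥-elim (<-irrefl refl (<-≤-trans x<v v≤x))
  ... | no _    = refl

  cwDist-self : ∀ v → cwDist v v ≡ 0
  cwDist-self v = trans (cwDist-≥ {v} {v} ≤-refl) (n∸n≡0 (toℕ v))

  cwDist<n : ∀ v x → cwDist v x ℕ.< n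
  cwDist<n v x with toℕ v ≤? toℕ x
  ... | yes _  = ≤-<-trans (m∸n≤m (toℕ x) (toℕ v)) (toℕ<n x)
  ... | no v≰x = begin-strict
    n ∸ toℕ v + toℕ x <⟨ +-monoʳ-< (n ∸ toℕ v) (≰⇒> v≰x) ⟩
    n ∸ toℕ v + toℕ v ≡⟨ m∸n+n≡m (<⇒≤ (toℕ<n v)) ⟩
    n                 ∎
    where open ≤-Reasoning

  data CwBefore (v x y : Fin n) : Set where
    v≤x<y : v ≤ x → x < y → CwBefore v x y
    y<v≤x : y < v → v ≤ x → CwBefore v x y
    x<y<v : x < y → y < v → CwBefore v x y

  CwBefore⇒cwDist< : ∀ {v x y} → CwBefore v x y → cwDist v x ℕ.< cwDist v y
  CwBefore⇒cwDist< {v} {x} {y} (v≤x<y v≤x x<y)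
    rewrite cwDist-≥ v≤x | cwDist-≥ (≤-trans v≤x (<⇒≤ x<y)) = ∸-monoˡ-< x<y v≤x
  CwBefore⇒cwDist< {v} {x} {y} (y<v≤x y<v v≤x)
    rewrite cwDist-≥ v≤x | cwDist-< y<v =
    <-≤-trans (∸-monoˡ-< (toℕ<n x) v≤x) (m≤m+n (n ∸ toℕ v) (toℕ y))
  CwBefore⇒cwDist< {v} {x} {y} (x<y<v x<y y<v)
    rewrite cwDist-< (<-trans x<y y<v) | cwDist-< y<v = +-monoʳ-< (n ∸ toℕ v) x<y

  CwBefore-total : ∀ v {x y} → x < y → CwBefore v x y ⊎ CwBefore v y x
  CwBefore-total v {x} {y} x<y with toℕ v ≤? toℕ x | toℕ v ≤? toℕ y
  ... | yes v≤x | _       = inj₁ (v≤x<y v≤x x<y)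
  ... | no v≰x  | yes v≤y = inj₂ (y<v≤x (≰⇒> v≰x) v≤y)
  ... | no _    | no v≰y  = inj₁ (x<y<v x<y (≰⇒> v≰y))

  cwDist<⇒CwBefore : ∀ {v x y} → cwDist v x ℕ.< cwDist v y → CwBefore v x y
  cwDist<⇒CwBefore {v} {x} {y} d< with <-cmp (toℕ x) (toℕ y)
  ... | tri≈ _ x≡y _ rewrite toℕ-injective {i = x} {j = y} x≡y = ⊥-elim (<-irrefl refl d<)
  ... | tri< x<y _ _ with CwBefore-total v x<y
  ...   | inj₁ x⟶y = x⟶y
  ...   | inj₂ y⟶x = ⊥-elim (<-asym d< (CwBefore⇒cwDist< y⟶x))
  cwDist<⇒CwBefore {v} {x} {y} d< | tri> _ _ y<x with CwBefore-total v y<x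
  ...   | inj₁ y⟶x = ⊥-elim (<-asym d< (CwBefore⇒cwDist< y⟶x))
  ...   | inj₂ x⟶y = x⟶y

  cwDist-≢ : ∀ v {x y} → x < y → cwDist v x ≢ cwDist v y
  cwDist-≢ v x<y d≡ with CwBefore-total v x<y
  ... | inj₁ x⟶y = <-irrefl d≡ (CwBefore⇒cwDist< x⟶y)
  ... | inj₂ y⟶x = <-irrefl (sym d≡) (CwBefore⇒cwDist< y⟶x)

  cwDist-injective : ∀ v {x y} → cwDist v x ≡ cwDist v y → x ≡ y
  cwDist-injective v {x} {y} d≡ with <-cmp (toℕ x) (toℕ y)
  ... | tri< x<y _ _ = ⊥-elim (cwDist-≢ v x<y d≡)
  ... | tri≈ _ x≡y _ = toℕ-injective x≡y
  ... | tri> _ _ y<x = ⊥-elim (cwDist-≢ v y<x (sym d≡))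

  CwBefore-≥ : ∀ {v x y} → v ≤ x → CwBefore v x y → x < y ⊎ y < v
  CwBefore-≥ _   (v≤x<y _ x<y)   = inj₁ x<y
  CwBefore-≥ _   (y<v≤x y<v _)   = inj₂ y<v
  CwBefore-≥ v≤x (x<y<v x<y y<v) = ⊥-elim (<-irrefl refl (<-≤-trans (<-trans x<y y<v) v≤x))

  CwBefore-< : ∀ {v x y} → x < v → CwBefore v x y → x < y × y < v
  CwBefore-< x<v (v≤x<y v≤x _)   = ⊥-elim (<-irrefl refl (<-≤-trans x<v v≤x))
  CwBefore-< x<v (y<v≤x _ v≤x)   = ⊥-elim (<-irrefl refl (<-≤-trans x<v v≤x))
  CwBefore-< _   (x<y<v x<y y<v) = x<y , y<v

module Faces (G : Outerplane) where
  open Outerplane G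
  open CyclicLists G
  open Clockwise n
  open import Data.List.Membership.DecPropositional (Data.Fin.Properties._≟_ {n}) using (_∈?_)

  Adj-sym : ∀ {u v} → Adj G u v → Adj G v u
  Adj-sym (inj₁ e)               = inj₂ (inj₁ e)
  Adj-sym (inj₂ (inj₁ e))        = inj₁ e
  Adj-sym (inj₂ (inj₂ (inj₁ e))) = inj₂ (inj₂ (inj₂ e))
  Adj-sym (inj₂ (inj₂ (inj₂ e))) = inj₂ (inj₂ (inj₁ e))

  chord⇒Adj : ∀ {a b} → (a , b) ∈ chords → Adj G a b
  chord⇒Adj ab = inj₂ (inj₂ (inj₁ ab))

  chord-long : ∀ {a b} → (a , b) ∈ chords → suc (toℕ a) ℕ.< toℕ b
  chord-long ab = proj₁ (All.lookup chord-ok ab)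

  spanning-edge : ∀ {a c b : Fin n} → a < c → c < b → Adj G a b →
                  (a , b) ∈ chords ⊎ (toℕ a ≡ 0 × suc (toℕ b) ≡ n)
  spanning-edge a<c c<b (inj₁ (inj₁ a+1≡b)) =
    ⊥-elim (<-irrefl refl (<-≤-trans a<c (ℕ.s≤s⁻¹ (subst (suc _ ℕ.≤_) (sym a+1≡b) c<b))))
  spanning-edge a<c c<b (inj₁ (inj₂ (_ , b≡0)))        = ⊥-elim (n≮0 (subst (_ ℕ.<_) b≡0 c<b))
  spanning-edge a<c c<b (inj₂ (inj₁ (inj₁ b+1≡a)))    =
    ⊥-elim (<-asym (<-trans a<c c<b) (subst (_ ℕ.<_) b+1≡a (n<1+n _)))
  spanning-edge _   _   (inj₂ (inj₁ (inj₂ (b+1≡n , a≡0)))) = inj₂ (a≡0 , b+1≡n)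
  spanning-edge _   _   (inj₂ (inj₂ (inj₁ ab)))       = inj₁ ab
  spanning-edge a<c c<b (inj₂ (inj₂ (inj₂ ba)))       =
    ⊥-elim (<-asym (<-trans a<c c<b) (<-trans (n<1+n _) (chord-long ba)))

  crossing : ∀ {a c b d : Fin n} → a < c → c < b → b < d → Adj G a b → Adj G c d → ⊥
  crossing {a} {c} {b} {d} a<c c<b b<d a~b c~d
    with spanning-edge a<c c<b a~b | spanning-edge c<b b<d c~d
  ... | inj₁ ab          | inj₁ cd         = noncrossing a b c d ab cd (a<c , c<b , b<d)
  ... | inj₂ (_ , b+1≡n) | _               =
    <-irrefl refl (<-≤-trans (toℕ<n d) (subst (ℕ._≤ toℕ d) b+1≡n b<d))
  ... | inj₁ _           | inj₂ (c≡0 , _)  = n≮0 (subst (toℕ a ℕ.<_) c≡0 a<c)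

  face-sorted : ∀ {f} → IsInnerFace G f → Sorted f
  face-sorted = proj₁

  face-edge : ∀ {f u v} → IsInnerFace G f → CycSucc G f u v → Adj G u v
  face-edge i = proj₁ (proj₂ (proj₂ i)) _ _

  face-chordless : ∀ {f u v} → IsInnerFace G f → u ∈ f → v ∈ f → Adj G u v →
                   CycSucc G f u v ⊎ CycSucc G f v u
  face-chordless i = proj₂ (proj₂ (proj₂ i)) _ _

  second<last : ∀ {h x t} → IsInnerFace G (h ∷ x ∷ t) → x < lastOf x t
  second<last {t = []}    (_ , s≤s (s≤s ()) , _)
  second<last {t = _ ∷ _} ((_ ∷ s) , _) =
    <-≤-trans (head<∈tail s (here refl)) (∈⇒≤lastOf s (there (here refl)))

  head<last : ∀ {h t} → IsInnerFace G (h ∷ t) → h < lastOf h t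
  head<last {t = []}    (_ , s≤s () , _)
  head<last {t = _ ∷ _} i@(h<x ∷ _ , _) = <-trans h<x (second<last i)

  head≢last : ∀ {h t} → IsInnerFace G (h ∷ t) → h ≢ lastOf h t
  head≢last i h≡last = <-irrefl (cong toℕ h≡last) (head<last i)

  head-last-not-consec : ∀ {h t} → IsInnerFace G (h ∷ t) → ¬ Consec G (h ∷ t) h (lastOf h t)
  head-last-not-consec {t = []}    (_ , s≤s () , _)
  head-last-not-consec {t = _ ∷ _} i c =
    <-irrefl (cong toℕ (consec-injectiveʳ (face-sorted i) here c)) (second<last i)

  face-succ-unique : ∀ {f x y y′} → IsInnerFace G f →
                     CycSucc G f x y → CycSucc G f x y′ → y ≡ y′
  face-succ-unique {[]}    (_ , () , _)
  face-succ-unique {_ ∷ _} i = cycSucc-injectiveʳ (face-sorted i)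

  face-pred-unique : ∀ {f x x′ y} → IsInnerFace G f →
                     CycSucc G f x y → CycSucc G f x′ y → x ≡ x′
  face-pred-unique {[]}    (_ , () , _)
  face-pred-unique {_ ∷ _} i = cycSucc-injectiveˡ (face-sorted i)

  face-succ-exists : ∀ {f x} → IsInnerFace G f → x ∈ f → ∃ λ y → CycSucc G f x y
  face-succ-exists {[]}    (_ , () , _)
  face-succ-exists {_ ∷ _} _ = cycSucc-total

  face-cycSucc-∈ : ∀ {f x y} → IsInnerFace G f → CycSucc G f x y → x ∈ f × y ∈ f
  face-cycSucc-∈ {[]}    (_ , () , _)
  face-cycSucc-∈ {_ ∷ _} _ = cycSucc-∈

  module _ {h t} (i : IsInnerFace G (h ∷ t)) where
    private
      s : Sorted (h ∷ t)
      s = face-sorted i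

    angle-CwBefore : ∀ {q v p} → CycSucc G (h ∷ t) q v → CycSucc G (h ∷ t) v p → CwBefore v p q
    angle-CwBefore q→v v→p with cycSucc⇒ q→v | cycSucc⇒ v→p
    ... | inj₁ q⇢v | inj₁ v⇢p = y<v≤x (consec-< s q⇢v) (<⇒≤ (consec-< s v⇢p))
    ... | inj₂ (refl , refl) | inj₁ h⇢p = v≤x<y (<⇒≤ (consec-< s h⇢p)) p<last
      where
      p<last = ≤∧≢⇒< (∈⇒≤lastOf s (proj₂ (consec-∈ h⇢p)))
        (λ p≡last → head-last-not-consec i (subst (Consec G _ h) (toℕ-injective p≡last) h⇢p))
    ... | inj₁ q⇢last | inj₂ (refl , refl) = x<y<v h<q (consec-< s q⇢last)
      where
      h<q = ≤∧≢⇒< (head≤∈ s (proj₁ (consec-∈ q⇢last)))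
        (λ h≡q → head-last-not-consec i (subst (λ z → Consec G _ z _) (sym (toℕ-injective h≡q)) q⇢last))
    ... | inj₂ (_ , v≡h) | inj₂ (v≡last , _) = ⊥-elim (head≢last i (trans (sym v≡h) v≡last))

    -- A vertex w off f lies between two consecutive boundary vertices of f or beyond the
    -- closing edge from lastOf h t to h; in each case an edge from v to w crosses that edge.
    no-edge-beyond : ∀ {v p w} → p ∈ h ∷ t → v < p → p < w → w ∉ h ∷ t → Adj G v w →
                     h < v ⊎ w < lastOf h t → ⊥
    no-edge-beyond p∈ v<p p<w w∉ v~w h<v⊎w<last with locate s w∉
    ... | inj₁ w<h = <-asym w<h (≤-<-trans (head≤∈ s p∈) p<w)
    ... | inj₂ (inj₁ (a , b , a⇢b , a<w , w<b)) =
      crossing (<-≤-trans v<p p≤a) a<w w<b v~w (face-edge i (consec⇒cycSucc a⇢b))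
      where
      p≤a = ≮⇒≥ (λ a<p → consec-gap s a⇢b p∈ a<p (<-trans p<w w<b))
    ... | inj₂ (inj₂ last<w) with h<v⊎w<last
    ...   | inj₁ h<v    = crossing h<v (<-≤-trans v<p (∈⇒≤lastOf s p∈)) last<w
                            (Adj-sym (face-edge i (cycSucc-wrap h t))) v~w
    ...   | inj₂ w<last = <-asym w<last last<w

    no-edge-before : ∀ {v q w} → q ∈ h ∷ t → w < q → q < v → w ∉ h ∷ t → Adj G v w →
                     v < lastOf h t ⊎ h < w → ⊥
    no-edge-before q∈ w<q q<v w∉ v~w v<last⊎h<w with locate s w∉
    ... | inj₂ (inj₂ last<w) = <-asym last<w (<-≤-trans w<q (∈⇒≤lastOf s q∈))
    ... | inj₂ (inj₁ (a , b , a⇢b , a<w , w<b)) =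
      crossing a<w w<b (≤-<-trans b≤q q<v) (face-edge i (consec⇒cycSucc a⇢b)) (Adj-sym v~w)
      where
      b≤q = ≮⇒≥ (λ q<b → consec-gap s a⇢b q∈ (<-trans a<w w<q) q<b)
    ... | inj₁ w<h with v<last⊎h<w
    ...   | inj₁ v<last = crossing w<h (≤-<-trans (head≤∈ s q∈) q<v) v<last
                            (Adj-sym v~w) (Adj-sym (face-edge i (cycSucc-wrap h t)))
    ...   | inj₂ h<w    = <-asym w<h h<w

    angle-empty-outside : ∀ {q v p w} → CycSucc G (h ∷ t) q v → CycSucc G (h ∷ t) v p →
                          Adj G v w → w ∉ h ∷ t → CwBefore v p w → CwBefore v w q → ⊥
    angle-empty-outside q→v v→p v~w w∉ p⟶w w⟶q with cycSucc⇒ q→v | cycSucc⇒ v→p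
    ... | inj₁ q⇢v | inj₁ v⇢p with CwBefore-≥ (<⇒≤ (consec-< s v⇢p)) p⟶w
    ...   | inj₁ p<w = no-edge-beyond (proj₂ (consec-∈ v⇢p)) (consec-< s v⇢p) p<w w∉ v~w
                         (inj₁ (≤-<-trans (head≤∈ s (proj₁ (consec-∈ q⇢v))) (consec-< s q⇢v)))
    ...   | inj₂ w<v = no-edge-before (proj₁ (consec-∈ q⇢v)) (proj₁ (CwBefore-< w<v w⟶q))
                         (consec-< s q⇢v) w∉ v~w
                         (inj₁ (<-≤-trans (consec-< s v⇢p) (∈⇒≤lastOf s (proj₂ (consec-∈ v⇢p)))))
    angle-empty-outside q→v v→p v~w w∉ p⟶w w⟶q | inj₂ (refl , refl) | inj₁ h⇢p
      with CwBefore-≥ (<⇒≤ (consec-< s h⇢p)) p⟶w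
    ... | inj₂ w<h = <-asym (proj₂ (CwBefore-< w<h w⟶q)) (head<last i)
    ... | inj₁ p<w with CwBefore-≥ (<⇒≤ (<-trans (consec-< s h⇢p) p<w)) w⟶q
    ...   | inj₁ w<last = no-edge-beyond (proj₂ (consec-∈ h⇢p)) (consec-< s h⇢p) p<w w∉ v~w (inj₂ w<last)
    ...   | inj₂ last<h = <-asym last<h (head<last i)
    angle-empty-outside q→v v→p v~w w∉ p⟶w w⟶q | inj₁ q⇢last | inj₂ (refl , refl) =
      no-edge-before (proj₁ (consec-∈ q⇢last)) w<q (consec-< s q⇢last) w∉ v~w (inj₂ h<w)
      where
      h<w = proj₁ (CwBefore-< (head<last i) p⟶w)
      w<q = proj₁ (CwBefore-< (proj₂ (CwBefore-< (head<last i) p⟶w)) w⟶q)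
    angle-empty-outside q→v v→p v~w w∉ p⟶w w⟶q | inj₂ (_ , v≡h) | inj₂ (v≡last , _) =
      head≢last i (trans (sym v≡h) v≡last)

  angle-ordered : ∀ {f q v p} → IsInnerFace G f → CycSucc G f q v → CycSucc G f v p →
                  cwDist v p ℕ.< cwDist v q
  angle-ordered {[]}    (_ , () , _)
  angle-ordered {_ ∷ _} i q→v v→p = CwBefore⇒cwDist< (angle-CwBefore i q→v v→p)

  angle-empty : ∀ {f q v p w} → IsInnerFace G f → CycSucc G f q v → CycSucc G f v p → Adj G v w →
                cwDist v p ℕ.< cwDist v w → cwDist v w ℕ.< cwDist v q → ⊥
  angle-empty {[]} (_ , () , _)
  angle-empty {h ∷ t} {w = w} i q→v v→p v~w p<w w<q with w ∈? h ∷ t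
  ... | no w∉ = angle-empty-outside i q→v v→p v~w w∉ (cwDist<⇒CwBefore p<w) (cwDist<⇒CwBefore w<q)
  ... | yes w∈ with face-chordless i (proj₂ (face-cycSucc-∈ i q→v)) w∈ v~w
  ...   | inj₁ v→w rewrite face-succ-unique i v→p v→w = <-irrefl refl p<w
  ...   | inj₂ w→v rewrite face-pred-unique i q→v w→v = <-irrefl refl w<q

  faces-agree-on-succ : ∀ {f g u v w w′} → IsInnerFace G f → IsInnerFace G g →
                        CycSucc G f u v → CycSucc G f v w → CycSucc G g u v → CycSucc G g v w′ →
                        w ≡ w′
  faces-agree-on-succ {v = v} {w} {w′} i j u→v v→w u→ᵍv v→ᵍw′ with <-cmp (cwDist v w) (cwDist v w′)
  ... | tri< w<w′ _ _ =
    ⊥-elim (angle-empty i u→v v→w (face-edge j v→ᵍw′) w<w′ (angle-ordered j u→ᵍv v→ᵍw′))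
  ... | tri≈ _ w≡w′ _ = cwDist-injective v w≡w′
  ... | tri> _ _ w′<w =
    ⊥-elim (angle-empty j u→ᵍv v→ᵍw′ (face-edge i v→w) w′<w (angle-ordered i u→v v→w))

  shared-edge⇒⊆ : ∀ {f g u v} → IsInnerFace G f → IsInnerFace G g →
                  CycSucc G f u v → CycSucc G g u v → ∀ {z} → z ∈ f → z ∈ g
  shared-edge⇒⊆ {[]} (_ , () , _)
  shared-edge⇒⊆ {h ∷ t} {g} {u} i j u→v u→ᵍv z∈ =
    proj₂ (face-cycSucc-∈ j (proj₂ (proj₂ (All.lookup shared z∈))))
    where
    SharedEdgeInto : Fin n → Set
    SharedEdgeInto x = ∃ λ y → CycSucc G (h ∷ t) y x × CycSucc G g y x

    propagate : ∀ {a b} → CycSucc G (h ∷ t) a b → SharedEdgeInto a → SharedEdgeInto b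
    propagate a→b (_ , y→a , y→ᵍa) with face-succ-exists j (proj₂ (face-cycSucc-∈ j y→ᵍa))
    ... | _ , a→ᵍb′ with faces-agree-on-succ i j y→a a→b y→ᵍa a→ᵍb′
    ...   | refl = _ , a→b , a→ᵍb′

    shared : All SharedEdgeInto (h ∷ t)
    shared = cycSucc-closed SharedEdgeInto propagate (proj₂ (cycSucc-∈ u→v)) (u , u→v , u→ᵍv)

  face-determined-by-edge : ∀ {f g u v} → IsInnerFace G f → IsInnerFace G g →
                            CycSucc G f u v → CycSucc G g u v → f ≡ g
  face-determined-by-edge i j u→v u→ᵍv =
    sorted-≡ (face-sorted i) (face-sorted j) (shared-edge⇒⊆ i j u→v u→ᵍv) (shared-edge⇒⊆ j i u→ᵍv u→v)

  chord-on-inner-side : ∀ {x a b} → IsInnerFace G x → InSide G x a b → a ∈ x → b ∈ x →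
                        (a , b) ∈ chords → CycSucc G x b a
  chord-on-inner-side {[]} (_ , () , _)
  chord-on-inner-side {h ∷ t} i inside a∈ b∈ ab with face-chordless i a∈ b∈ (chord⇒Adj ab)
  ... | inj₂ b→a = b→a
  ... | inj₁ a→b with cycSucc⇒ a→b
  ...   | inj₂ (refl , refl) = ⊥-elim (<-asym (head<last i) (<-trans (n<1+n _) (chord-long ab)))
  ...   | inj₁ a⇢b = ⊥-elim (head-last-not-consec i (subst₂ (Consec G (h ∷ t)) a≡h b≡last a⇢b))
    where
    s = face-sorted i
    a≡h = toℕ-injective (≤-antisym (proj₁ (All.lookup inside (here refl))) (head≤∈ s a∈))
    b≡last = toℕ-injective (≤-antisym (∈⇒≤lastOf s b∈) (proj₂ (All.lookup inside (lastOf-∈ h t))))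

  angle-on-one-side : ∀ {g y α u p q} → IsInnerFace G g → IsInnerFace G y → g ≢ y →
                      CycSucc G y α u → CycSucc G g q α → CycSucc G g α p →
                      cwDist α p ℕ.≤ cwDist α u ⇔ cwDist α q ℕ.≤ cwDist α u
  angle-on-one-side {α = α} {u} {p} {q} ig iy g≢y α→u q→α α→p = mk⇔ to from
    where
    to : cwDist α p ℕ.≤ cwDist α u → cwDist α q ℕ.≤ cwDist α u
    to p≤u with m≤n⇒m<n∨m≡n p≤u
    ... | inj₁ p<u = ≮⇒≥ (angle-empty ig q→α α→p (face-edge iy α→u) p<u)
    ... | inj₂ p≡u with cwDist-injective α p≡u
    ...   | refl = ⊥-elim (g≢y (face-determined-by-edge ig iy α→p α→u))
    from : cwDist α q ℕ.≤ cwDist α u → cwDist α p ℕ.≤ cwDist α u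
    from q≤u = <⇒≤ (<-≤-trans (angle-ordered ig q→α α→p) q≤u)

  shared-edge-reversed : ∀ {f g u v} → IsInnerFace G f → IsInnerFace G g → f ≢ g →
                         u ∈ g → v ∈ g → Adj G u v → CycSucc G f u v → CycSucc G g v u
  shared-edge-reversed if ig f≢g u∈ v∈ u~v u→v with face-chordless ig u∈ v∈ u~v
  ... | inj₁ u→ᵍv = ⊥-elim (f≢g (face-determined-by-edge if ig u→v u→ᵍv))
  ... | inj₂ v→ᵍu = v→ᵍu

module OuterCycle (G : Outerplane) where
  open Outerplane G
  open Clockwise n
  open Faces G

  0<n : 0 ℕ.< n
  0<n = <-≤-trans (s≤s z≤n) 3≤n

  next : Vertex G → Vertex G
  next v with suc (toℕ v) <? n
  ... | yes v+1<n = fromℕ< v+1<n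
  ... | no _      = fromℕ< 0<n

  next-outer : ∀ v → OuterEdge G v (next v)
  next-outer v with suc (toℕ v) <? n
  ... | yes v+1<n rewrite toℕ-fromℕ< v+1<n = inj₁ refl
  ... | no v+1≮n  rewrite toℕ-fromℕ< 0<n   = inj₂ (≤-antisym (toℕ<n v) (≮⇒≥ v+1≮n) , refl)

  suc-pred-n : suc (ℕ.pred n) ≡ n
  suc-pred-n = suc-pred n {{ℕ.>-nonZero 0<n}}

  prevℕ : ℕ → ℕ
  prevℕ zero    = ℕ.pred n
  prevℕ (suc k) = k

  prevℕ<n : ∀ k → k ℕ.< n → prevℕ k ℕ.< n
  prevℕ<n zero    _     = ≤-reflexive suc-pred-n
  prevℕ<n (suc k) k+1<n = <-trans (n<1+n k) k+1<n

  prev : Vertex G → Vertex G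
  prev v = fromℕ< (prevℕ<n (toℕ v) (toℕ<n v))

  prev-outer : ∀ v → OuterEdge G (prev v) v
  prev-outer v rewrite toℕ-fromℕ< (prevℕ<n (toℕ v) (toℕ<n v)) = outer-prevℕ (toℕ v)
    where
    outer-prevℕ : ∀ k → suc (prevℕ k) ≡ k ⊎ (suc (prevℕ k) ≡ n × k ≡ 0)
    outer-prevℕ zero    = inj₂ (suc-pred-n , refl)
    outer-prevℕ (suc k) = inj₁ refl

  OuterEdge-injectiveʳ : ∀ {u v v′} → OuterEdge G u v → OuterEdge G u v′ → v ≡ v′
  OuterEdge-injectiveʳ (inj₁ u+1≡v)        (inj₁ u+1≡v′)       =
    toℕ-injective (trans (sym u+1≡v) u+1≡v′)
  OuterEdge-injectiveʳ {v = v} (inj₁ u+1≡v) (inj₂ (u+1≡n , _)) =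
    ⊥-elim (<-irrefl (trans (sym u+1≡v) u+1≡n) (toℕ<n v))
  OuterEdge-injectiveʳ {v′ = v′} (inj₂ (u+1≡n , _)) (inj₁ u+1≡v′) =
    ⊥-elim (<-irrefl (trans (sym u+1≡v′) u+1≡n) (toℕ<n v′))
  OuterEdge-injectiveʳ (inj₂ (_ , v≡0))    (inj₂ (_ , v′≡0))   =
    toℕ-injective (trans v≡0 (sym v′≡0))

  OuterEdge-injectiveˡ : ∀ {u u′ v} → OuterEdge G u v → OuterEdge G u′ v → u ≡ u′
  OuterEdge-injectiveˡ (inj₁ u+1≡v)       (inj₁ u′+1≡v)       =
    toℕ-injective (suc-injective (trans u+1≡v (sym u′+1≡v)))
  OuterEdge-injectiveˡ (inj₁ u+1≡v)       (inj₂ (_ , v≡0))    with trans u+1≡v v≡0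
  ... | ()
  OuterEdge-injectiveˡ (inj₂ (_ , v≡0))   (inj₁ u′+1≡v)       with trans u′+1≡v v≡0
  ... | ()
  OuterEdge-injectiveˡ (inj₂ (u+1≡n , _)) (inj₂ (u′+1≡n , _)) =
    toℕ-injective (suc-injective (trans u+1≡n (sym u′+1≡n)))

  cwDist-outerEdge : ∀ {u v} → OuterEdge G u v → cwDist u v ≡ 1
  cwDist-outerEdge {u} {v} (inj₁ u+1≡v) = begin
    cwDist u v            ≡⟨ cwDist-≥ {u} {v} (subst (toℕ u ℕ.≤_) u+1≡v (n≤1+n _)) ⟩
    toℕ v ∸ toℕ u         ≡⟨ cong (_∸ toℕ u) (sym u+1≡v) ⟩
    suc (toℕ u) ∸ toℕ u   ≡⟨ m+n∸n≡m 1 (toℕ u) ⟩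
    1                     ∎
    where open ≡-Reasoning
  cwDist-outerEdge {u} {v} (inj₂ (u+1≡n , v≡0)) = begin
    cwDist u v              ≡⟨ cwDist-< {u} {v} v<u ⟩
    n ∸ toℕ u + toℕ v       ≡⟨ cong₂ _+_ (cong (_∸ toℕ u) (sym u+1≡n)) v≡0 ⟩
    suc (toℕ u) ∸ toℕ u + 0 ≡⟨ cong (_+ 0) (m+n∸n≡m 1 (toℕ u)) ⟩
    1                       ∎
    where
    open ≡-Reasoning
    v<u : v < u
    v<u = subst (ℕ._< toℕ u) (sym v≡0)
            (<-≤-trans (s≤s z≤n) (ℕ.s≤s⁻¹ (subst (3 ℕ.≤_) (sym u+1≡n) 3≤n)))

  cwDist-outerEdge⁻ : ∀ {u v} → OuterEdge G u v → suc (cwDist v u) ≡ n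
  cwDist-outerEdge⁻ {u} {v} (inj₁ u+1≡v) = begin
    suc (cwDist v u)          ≡⟨ cong suc (cwDist-< {v} {u} (subst (toℕ u ℕ.<_) u+1≡v (n<1+n _))) ⟩
    suc (n ∸ toℕ v + toℕ u)   ≡⟨ sym (+-suc (n ∸ toℕ v) (toℕ u)) ⟩
    n ∸ toℕ v + suc (toℕ u)   ≡⟨ cong (n ∸ toℕ v +_) u+1≡v ⟩
    n ∸ toℕ v + toℕ v         ≡⟨ m∸n+n≡m (<⇒≤ (toℕ<n v)) ⟩
    n                         ∎
    where open ≡-Reasoning
  cwDist-outerEdge⁻ {u} {v} (inj₂ (u+1≡n , v≡0)) = begin
    suc (cwDist v u)          ≡⟨ cong suc (cwDist-≥ {v} {u} (subst (ℕ._≤ toℕ u) (sym v≡0) z≤n)) ⟩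
    suc (toℕ u ∸ toℕ v)       ≡⟨ cong (λ k → suc (toℕ u ∸ k)) v≡0 ⟩
    suc (toℕ u)               ≡⟨ u+1≡n ⟩
    n                         ∎
    where open ≡-Reasoning

  chord-not-outerEdge : ∀ {a b} → (a , b) ∈ chords → ¬ (OuterEdge G a b ⊎ OuterEdge G b a)
  chord-not-outerEdge ab (inj₁ (inj₁ a+1≡b)) = <-irrefl a+1≡b (chord-long ab)
  chord-not-outerEdge ab (inj₁ (inj₂ (_ , b≡0))) =
    n≮0 (subst (_ ℕ.<_) b≡0 (<-trans (n<1+n _) (chord-long ab)))
  chord-not-outerEdge ab (inj₂ (inj₁ b+1≡a)) =
    <-asym (subst (_ ℕ.<_) b+1≡a (n<1+n _)) (<-trans (n<1+n _) (chord-long ab))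
  chord-not-outerEdge ab (inj₂ (inj₂ (b+1≡n , a≡0))) = proj₂ (All.lookup chord-ok ab) (a≡0 , b+1≡n)

module Flips (G : Outerplane) (c : Vertex G → Bool) where
  open Outerplane G
  open CyclicLists G
  open Clockwise n
  open Faces G
  open import Data.List.Membership.DecPropositional (Data.Fin.Properties._≟_ {n}) using (_∈?_)

  Matching : Set
  Matching = Vertex G → Vertex G

  step-face : ∀ {g m₁ m₂} → ZStep G c g m₁ m₂ → IsInnerFace G g
  step-face = proj₁

  step-fixes : ∀ {g m₁ m₂ v} → ZStep G c g m₁ m₂ → v ∉ g → m₁ v ≡ m₂ v
  step-fixes st = proj₁ (proj₂ st) _

  step-white : ∀ {g m₁ m₂ v} → ZStep G c g m₁ m₂ → v ∈ g → c v ≡ true →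
               CycSucc G g v (m₁ v) × CycSucc G g (m₂ v) v
  step-white st = proj₁ (proj₂ (proj₂ st)) _

  step-black : ∀ {g m₁ m₂ v} → ZStep G c g m₁ m₂ → v ∈ g → c v ≡ false →
               CycSucc G g (m₁ v) v × CycSucc G g v (m₂ v)
  step-black st = proj₂ (proj₂ (proj₂ st)) _

  step-moves⇒∈ : ∀ {g m₁ m₂ v} → ZStep G c g m₁ m₂ → m₁ v ≢ m₂ v → v ∈ g
  step-moves⇒∈ {g} {v = v} st moved with v ∈? g
  ... | yes v∈ = v∈
  ... | no v∉  = ⊥-elim (moved (step-fixes st v∉))

  PartnerUpTo : Vertex G → Vertex G → Matching → Set
  PartnerUpTo α u m = cwDist α (m α) ℕ.≤ cwDist α u

  PartnerUpTo-stable : ∀ {g y m₁ m₂ α u} → ZStep G c g m₁ m₂ → IsInnerFace G y → g ≢ y →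
                       CycSucc G y α u → PartnerUpTo α u m₁ ⇔ PartnerUpTo α u m₂
  PartnerUpTo-stable {g} {α = α} st iy g≢y α→u with α ∈? g
  ... | no α∉ rewrite step-fixes st α∉ = ⇔.refl
  ... | yes α∈ with c α in colour
  ...   | true  = let α→p , q→α = step-white st α∈ colour in
                  angle-on-one-side (step-face st) iy g≢y α→u q→α α→p
  ...   | false = let q→α , α→p = step-black st α∈ colour in
                  ⇔.sym (angle-on-one-side (step-face st) iy g≢y α→u q→α α→p)

  FlippedAt : Bool → Set → Set
  FlippedAt true  P = ¬ P
  FlippedAt false P = P

  FlippedAt-cong : ∀ b {P Q} → P ⇔ Q → FlippedAt b P → FlippedAt b Q
  FlippedAt-cong true  P⇔Q ¬P q = ¬P (Equivalence.from P⇔Q q)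
  FlippedAt-cong false P⇔Q p    = Equivalence.to P⇔Q p

  Flipped : Face G → Matching → Set
  Flipped (α ∷ u ∷ _) m = FlippedAt (c α) (PartnerUpTo α u m)
  Flipped _           _ = ⊥

  flipped-by-step : ∀ {y m₁ m₂} → ZStep G c y m₁ m₂ → Flipped y m₂ × ¬ Flipped y m₁
  flipped-by-step {[]}        ((_ , () , _) , _)
  flipped-by-step {_ ∷ []}    ((_ , s≤s () , _) , _)
  flipped-by-step {α ∷ u ∷ _} {m₁} {m₂} st = flips (c α) refl
    where
    iy = step-face st
    α→u = consec⇒cycSucc here
    flips : ∀ b → c α ≡ b → FlippedAt b (PartnerUpTo α u m₂) × ¬ FlippedAt b (PartnerUpTo α u m₁)
    flips true colour =
      let α→m₁α , m₂α→α = step-white st (here refl) colour in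
      (λ m₂α≤u → <-irrefl refl (<-≤-trans (angle-ordered iy m₂α→α α→u) m₂α≤u)) ,
      (λ ¬m₁α≤u → ¬m₁α≤u (≤-reflexive (cong (cwDist α) (face-succ-unique iy α→m₁α α→u))))
    flips false colour =
      let m₁α→α , α→m₂α = step-black st (here refl) colour in
      ≤-reflexive (cong (cwDist α) (face-succ-unique iy α→m₂α α→u)) ,
      (λ m₁α≤u → <-irrefl refl (<-≤-trans (angle-ordered iy m₁α→α α→u) m₁α≤u))

  flipped-stable : ∀ {g y m₁ m₂} → ZStep G c g m₁ m₂ → IsInnerFace G y → g ≢ y →
                   Flipped y m₁ → Flipped y m₂
  flipped-stable {y = []}        _  _  _   ()
  flipped-stable {y = _ ∷ []}    _  _  _   ()
  flipped-stable {y = α ∷ u ∷ _} st iy g≢y =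
    FlippedAt-cong (c α) (PartnerUpTo-stable st iy g≢y (consec⇒cycSucc here))

  flipped-preserved : ∀ {g y m₁ m₂} → ZStep G c g m₁ m₂ → IsInnerFace G y →
                      Flipped y m₁ → Flipped y m₂
  flipped-preserved {g} {y} st iy with ≡-dec Data.Fin.Properties._≟_ g y
  ... | yes refl = λ _ → proj₁ (flipped-by-step st)
  ... | no g≢y   = flipped-stable st iy g≢y

  flipped-cong : ∀ {y m m′} → (∀ v → m v ≡ m′ v) → Flipped y m → Flipped y m′
  flipped-cong {[]}        _    ()
  flipped-cong {_ ∷ []}    _    ()
  flipped-cong {α ∷ _ ∷ _} m≗m′ rewrite m≗m′ α = id

  flipped-along : ∀ {m m′ fs y} → ZSeq G c m m′ fs → IsInnerFace G y → Flipped y m → Flipped y m′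
  flipped-along {y = y} (done _ m≗m′) _ = flipped-cong {y} m≗m′
  flipped-along (step _ _ st zs) iy = flipped-along zs iy ∘ flipped-preserved st iy

  flipped-after : ∀ {m m′ fs y} → ZSeq G c m m′ fs → y ∈ fs → Flipped y m′
  flipped-after (step _ _ st zs) (here refl) = flipped-along zs (step-face st) (proj₁ (flipped-by-step st))
  flipped-after (step _ _ _  zs) (there y∈)  = flipped-after zs y∈

  flipped⇒not-transformed : ∀ {m m′ fs y} → ZSeq G c m m′ fs → IsInnerFace G y → Flipped y m →
                            All (y ≢_) fs
  flipped⇒not-transformed (done _ _)       _  _       = []
  flipped⇒not-transformed (step _ _ st zs) iy flipped =
    (λ { refl → proj₂ (flipped-by-step st) flipped }) ∷
    flipped⇒not-transformed zs iy (flipped-preserved st iy flipped)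

  ZSeq-unique : ∀ {m m′ fs} → ZSeq G c m m′ fs → Unique fs
  ZSeq-unique (done _ _)       = []
  ZSeq-unique (step _ _ st zs) =
    flipped⇒not-transformed zs (step-face st) (proj₁ (flipped-by-step st)) ∷ ZSeq-unique zs

module OuterMatching (G : Outerplane) (c : Vertex G → Bool) (proper : ProperColouring G c) where
  open Outerplane G
  open Clockwise n
  open Faces G
  open OuterCycle G
  open Flips G c

  outer : Matching
  outer v = if c v then next v else prev v

  outer-white : ∀ {v} → c v ≡ true → outer v ≡ next v
  outer-white {v} white rewrite white = refl

  outer-black : ∀ {v} → c v ≡ false → outer v ≡ prev v
  outer-black {v} black rewrite black = refl

  colour-flips : ∀ {u v} → Adj G u v → c v ≡ not (c u)
  colour-flips u~v = ¬-not (proper _ _ (Adj-sym u~v))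

  outer-outerEdge : ∀ v → OuterEdge G v (outer v) ⊎ OuterEdge G (outer v) v
  outer-outerEdge v with c v
  ... | true  = inj₁ (next-outer v)
  ... | false = inj₂ (prev-outer v)

  outer-isPM : IsPM G c outer
  outer-isPM = involutive , λ v → Sum.map₂ inj₁ (outer-outerEdge v)
    where
    involutive : ∀ v → outer (outer v) ≡ v
    involutive v = by-colour (c v) refl
      where
      by-colour : ∀ b → c v ≡ b → outer (outer v) ≡ v
      by-colour true white = begin
        outer (outer v) ≡⟨ cong outer (outer-white white) ⟩
        outer (next v)  ≡⟨ outer-black (trans (colour-flips (inj₁ (next-outer v))) (cong not white)) ⟩
        prev (next v)   ≡⟨ OuterEdge-injectiveˡ (prev-outer (next v)) (next-outer v) ⟩
        v               ∎
        where open ≡-Reasoning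
      by-colour false black = begin
        outer (outer v) ≡⟨ cong outer (outer-black black) ⟩
        outer (prev v)  ≡⟨ outer-white (trans (colour-flips (inj₂ (inj₁ (prev-outer v)))) (cong not black)) ⟩
        next (prev v)   ≡⟨ OuterEdge-injectiveʳ (next-outer (prev v)) (prev-outer v) ⟩
        v               ∎
        where open ≡-Reasoning

  outer-unflipped : ∀ {y} → IsInnerFace G y → ¬ Flipped y outer
  outer-unflipped {[]}            (_ , () , _)
  outer-unflipped {_ ∷ []}        (_ , s≤s () , _)
  outer-unflipped {_ ∷ _ ∷ []}    (_ , s≤s (s≤s ()) , _)
  outer-unflipped {α ∷ u ∷ t ∷ _} ((α<u ∷ u<t ∷ _) , _) = unflipped (c α) refl
    where
    open ≤-Reasoning
    0<u : 0 ℕ.< cwDist α u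
    0<u = subst (ℕ._< cwDist α u) (cwDist-self α) (CwBefore⇒cwDist< (v≤x<y ≤-refl α<u))

    unflipped : ∀ b → c α ≡ b → ¬ FlippedAt b (PartnerUpTo α u outer)
    unflipped true  white beyond-u = beyond-u (begin
      cwDist α (outer α) ≡⟨ cong (cwDist α) (outer-white white) ⟩
      cwDist α (next α)  ≡⟨ cwDist-outerEdge (next-outer α) ⟩
      1                  ≤⟨ 0<u ⟩
      cwDist α u         ∎)
    unflipped false black up-to-u = <-irrefl refl (begin-strict
      n                        ≡⟨ sym (cwDist-outerEdge⁻ (prev-outer α)) ⟩
      suc (cwDist α (prev α))  ≡⟨ cong (suc ∘ cwDist α) (sym (outer-black black)) ⟩
      suc (cwDist α (outer α)) ≤⟨ s≤s up-to-u ⟩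
      suc (cwDist α u)         ≤⟨ CwBefore⇒cwDist< (v≤x<y (<⇒≤ α<u) u<t) ⟩
      cwDist α t               <⟨ cwDist<n α t ⟩
      n                        ∎)

  top-is-outer : ∀ {mt} → IsTop G c mt → ∀ v → mt v ≡ outer v
  top-is-outer (_ , above-all) with above-all outer outer-isPM
  ... | [] , done _ mt≗outer = mt≗outer
  ... | _ ∷ _ , zs@(step _ _ st _) =
    ⊥-elim (outer-unflipped (step-face st) (flipped-after zs (here refl)))

  outer-avoids-chords : ∀ {a b} → (a , b) ∈ chords ⊎ (b , a) ∈ chords → outer a ≢ b
  outer-avoids-chords {a} chord outer-a≡b
    with subst (λ z → OuterEdge G a z ⊎ OuterEdge G z a) outer-a≡b (outer-outerEdge a) | chord
  ... | outer-edge | inj₁ ab = chord-not-outerEdge ab outer-edge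
  ... | outer-edge | inj₂ ba = chord-not-outerEdge ba (Sum.swap outer-edge)

module FaceOrder (G : Outerplane) (c : Vertex G → Bool) (proper : ProperColouring G c) where
  open Outerplane G
  open Faces G
  open Flips G c
  open OuterMatching G c proper

  record SeparatingChord (x y : Face G) : Set where
    field
      white black      : Vertex G
      white-is-white   : c white ≡ true
      is-chord         : (white , black) ∈ chords ⊎ (black , white) ∈ chords
      inner-x          : IsInnerFace G x
      inner-y          : IsInnerFace G y
      black→white-on-x : CycSucc G x black white
      white→black-on-y : CycSucc G y white black

  dualArc⇒SeparatingChord : ∀ {x y} → DualArc G c x y → SeparatingChord x y
  dualArc⇒SeparatingChord
    (ix , iy , x≢y , a , b , ab , a∈x , b∈x , a∈y , b∈y , inj₁ (x-inside , a-white)) =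
    record
      { white = a ; black = b ; white-is-white = a-white ; is-chord = inj₁ ab
      ; inner-x = ix ; inner-y = iy
      ; black→white-on-x = b→a
      ; white→black-on-y = shared-edge-reversed ix iy x≢y b∈y a∈y (Adj-sym (chord⇒Adj ab)) b→a
      }
    where b→a = chord-on-inner-side ix x-inside a∈x b∈x ab
  dualArc⇒SeparatingChord
    (ix , iy , x≢y , a , b , ab , a∈x , b∈x , a∈y , b∈y , inj₂ (y-inside , b-white)) =
    record
      { white = b ; black = a ; white-is-white = b-white ; is-chord = inj₂ ab
      ; inner-x = ix ; inner-y = iy
      ; black→white-on-x = shared-edge-reversed iy ix (x≢y ∘ sym) b∈x a∈x (Adj-sym (chord⇒Adj ab)) b→a
      ; white→black-on-y = b→a
      }
    where b→a = chord-on-inner-side iy y-inside a∈y b∈y ab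

  OccursBefore : (fs : List (Face G)) → Fin (length fs) → Face G → Set
  OccursBefore fs j x = Σ (Fin (length fs)) λ i → toℕ i ℕ.< toℕ j × lookup fs i ≡ x

  module _ {x y} (S : SeparatingChord x y) where
    open SeparatingChord S

    matched-only-at-x : ∀ {g m₁ m₂} → ZStep G c g m₁ m₂ →
                        m₁ white ≢ black → m₂ white ≡ black → g ≡ x
    matched-only-at-x {g} st unmatched matched =
      face-determined-by-edge (step-face st) inner-x
        (subst (λ z → CycSucc G g z white) matched (proj₂ (step-white st white∈ white-is-white)))
        black→white-on-x
      where white∈ = step-moves⇒∈ st (λ m₁≡m₂ → unmatched (trans m₁≡m₂ matched))

    matched-at-y : ∀ {m₁ m₂} → ZStep G c y m₁ m₂ → m₁ white ≡ black
    matched-at-y st = face-succ-unique inner-y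
      (proj₁ (step-white st (proj₁ (face-cycSucc-∈ inner-y white→black-on-y)) white-is-white))
      white→black-on-y

    y-preceded-by-x : ∀ {m m′ fs} → ZSeq G c m m′ fs → m white ≢ black →
                      ∀ j → lookup fs j ≡ y → OccursBefore fs j x
    y-preceded-by-x (step _ _ st _) unmatched F.zero refl = ⊥-elim (unmatched (matched-at-y st))
    y-preceded-by-x (step {m₂ = m₂} _ _ st zs) unmatched (F.suc j) yⱼ with m₂ white F.≟ black
    ... | yes matched = F.zero , s≤s z≤n , matched-only-at-x st unmatched matched
    ... | no unmatched′ with y-preceded-by-x zs unmatched′ j yⱼ
    ...   | i , i<j , xᵢ = F.suc i , s≤s i<j , xᵢ

  dualArc-order : ∀ {x y mt m fs} → DualArc G c x y → IsTop G c mt → ZSeq G c mt m fs →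
                  ∀ j → lookup fs j ≡ y → OccursBefore fs j x
  dualArc-order arc top zs = y-preceded-by-x S zs λ matched →
    outer-avoids-chords is-chord (trans (sym (top-is-outer top white)) matched)
    where
    S = dualArc⇒SeparatingChord arc
    open SeparatingChord S

  ⪯F-order : ∀ {x z mt m fs} → Star (DualArc G c) x z → IsTop G c mt → ZSeq G c mt m fs →
             ∀ j → lookup fs j ≡ z → Σ (Fin (length fs)) λ i → toℕ i ℕ.≤ toℕ j × lookup fs i ≡ x
  ⪯F-order ε            _   _  j zⱼ = j , ≤-refl , zⱼ
  ⪯F-order (arc ◅ path) top zs j zⱼ with ⪯F-order path top zs j zⱼ
  ... | i′ , i′≤j , yᵢ′ with dualArc-order arc top zs i′ yᵢ′
  ...   | i , i<i′ , xᵢ = i , <⇒≤ (<-≤-trans i<i′ i′≤j) , xᵢ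

  transformed-before : ∀ {f f′ mt m fs} → f ≢ f′ → _⪯F_ G c f′ f → IsTop G c mt → ZSeq G c mt m fs →
                       ∀ j → lookup fs j ≡ f′ → OccursBefore fs j f
  transformed-before f≢f′ f′⪯f top zs j f′ⱼ with ⪯F-order f′⪯f top zs j f′ⱼ
  ... | i , i≤j , fᵢ with m≤n⇒m<n∨m≡n i≤j
  ...   | inj₁ i<j = i , i<j , fᵢ
  ...   | inj₂ i≡j rewrite toℕ-injective i≡j = ⊥-elim (f≢f′ (trans (sym fᵢ) f′ⱼ))

  transformed-strictly-before : ∀ {f f′ mt m fs} → f ≢ f′ → _⪯F_ G c f′ f → IsTop G c mt →
                                ZSeq G c mt m fs → ∀ i j → lookup fs i ≡ f → lookup fs j ≡ f′ →
                                toℕ i ℕ.< toℕ j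
  transformed-strictly-before f≢f′ f′⪯f top zs i j fᵢ f′ⱼ
    with transformed-before f≢f′ f′⪯f top zs j f′ⱼ
  ... | i′ , i′<j , fᵢ′ rewrite lookup-injective (ZSeq-unique zs) i i′ (trans fᵢ (sym fᵢ′)) = i′<j

lemma5p2 : (G : Outerplane) (c : Vertex G → Bool) → ProperColouring G c →
    ((f f' : Face G) → IsInnerFace G f → IsInnerFace G f' → f ≢ f' →
       _⪯F_ G c f' f →
       (mt mb : Vertex G → Vertex G) → IsTop G c mt → IsBottom G c mb →
       (fs : List (Face G)) → ZSeq G c mt mb fs →
       ((j : Fin (length fs)) → lookup fs j ≡ f' →
          Σ (Fin (length fs)) λ i → toℕ i ℕ.< toℕ j × lookup fs i ≡ f) ×
       ((i j : Fin (length fs)) → lookup fs i ≡ f → lookup fs j ≡ f' →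
          toℕ i ℕ.< toℕ j))
    ×
    ((m m' : Vertex G → Vertex G) (fs : List (Face G)) → ZSeq G c m m' fs →
       Unique fs)
-- The order part holds for sequences from the top matching to any matching, not only the bottom one.
lemma5p2 G c proper =
  (λ _ _ _ _ f≢f′ f′⪯f _ _ top _ _ zs →
     transformed-before f≢f′ f′⪯f top zs , transformed-strictly-before f≢f′ f′⪯f top zs) ,
  λ _ _ _ → ZSeq-unique
  where
  open Flips G c
  open FaceOrder G c proper
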